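{- For all $k,m\in\mathbb{N}$ there is some $\varepsilon=\varepsilon(k,m)>0$ such that the following holds for every $k$-graph $H$ and all non-empty, pairwise disjoint sets $B_1,\dots,B_m\subseteq V(H)$. If $|\mathrm{Lk}(v;B_{i_1},\dots,B_{i_{k-1}})|\le\varepsilon|B_{i_1}|\cdots|B_{i_{k-1}}|$ for all $i\in\{k,\dots,m\}$, all $1\le i_1<\dots<i_{k-1}<i$ and all $v\in B_i$, then there is an independent transversal, i.e. an independent set $\{v_1,\dots,v_m\}$ of $H$ with $v_i\in B_i$ for all $i\in[m]$.
   Context: For a $k$-graph $H$, a vertex $v$ and disjoint sets $V_1,\dots,V_{k-1}\subseteq V(H)\setminus\{v\}$, the link graph $\mathrm{Lk}(v;V_1,\dots,V_{k-1})$ is the $(k-1)$-graph with parts $V_1,\dots,V_{k-1}$ whose edges are the sets $e$ containing exactly one vertex from each $V_j$ such that $e\cup\{v\}\in E(H)$; $|\mathrm{Lk}(\cdot)|$ is its number of edges. A set of vertices is independent if it contains no edge of $H$. -}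

module Defs where

open import Data.Bool using (Bool; true; false; T; _∧_)
open import Data.Nat using (ℕ; zero; suc)
import Data.Nat as ℕ
open import Data.Fin using (Fin)
import Data.Fin as Fin
open import Data.Fin.Properties using (all?)
open import Data.Fin.Subset using (Subset; ⁅_⁆; _∈_; _⊆_; _∩_; _∪_; ⋃; ∣_∣; Nonempty; Empty)
open import Data.Fin.Subset.Properties using (_⊆?_)
open import Data.List using (List; []; _∷_; _++_; map; filterᵇ; length; tabulate)
open import Data.Nat.ListAction using (product)
open import Data.Vec using (Vec)
import Data.Vec as Vec
open import Relation.Nullary using (¬_)
open import Relation.Nullary.Decidable using (⌊_⌋)
open import Relation.Binary.PropositionalEquality using (_≡_)
open import Data.Product using (∃; _×_)

record Hypergraph (k n : ℕ) : Set where
  field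
    edge    : Subset n → Bool
    uniform : ∀ e → T (edge e) → ∣ e ∣ ≡ k
open Hypergraph public

allSubsets : (n : ℕ) → List (Subset n)
allSubsets zero    = Vec.[] ∷ []
allSubsets (suc n) = map (true Vec.∷_) (allSubsets n) ++ map (false Vec.∷_) (allSubsets n)

isLinkEdge : ∀ {k n r} → Hypergraph k n → Fin n → (Fin r → Subset n) → Subset n → Bool
isLinkEdge H v V e =
  edge H (e ∪ ⁅ v ⁆)
  ∧ ⌊ all? (λ j → ∣ e ∩ V j ∣ ℕ.≟ 1) ⌋
  ∧ ⌊ e ⊆? ⋃ (tabulate V) ⌋

linkSize : ∀ {k n r} → Hypergraph k n → Fin n → (Fin r → Subset n) → ℕ
linkSize {n = n} H v V = length (filterᵇ (isLinkEdge H v V) (allSubsets n))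

sizeProduct : ∀ {n r} → (Fin r → Subset n) → ℕ
sizeProduct V = product (tabulate (λ j → ∣ V j ∣))

Independent : ∀ {k n} → Hypergraph k n → Subset n → Set
Independent H S = ∀ e → T (edge H e) → ¬ (e ⊆ S)

imageSet : ∀ {n m} → (Fin m → Fin n) → Subset n
imageSet t = ⋃ (tabulate (λ i → ⁅ t i ⁆))

PairwiseDisjoint : ∀ {n m} → (Fin m → Subset n) → Set
PairwiseDisjoint B = ∀ i j → ¬ (i ≡ j) → Empty (B i ∩ B j)

StrictlyIncreasing : ∀ {r m} → (Fin r → Fin m) → Set
StrictlyIncreasing f = ∀ a b → a Fin.< b → f a Fin.< f b

IndependentTransversal : ∀ {k n m} → Hypergraph k n → (Fin m → Subset n) → Set
IndependentTransversal H B =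
  ∃ λ (t : Fin _ → Fin _) → (∀ i → t i ∈ B i) × Independent H (imageSet t)

module Submission where

-- Choose a transversal t of B₁, …, Bₘ uniformly at random. For parts i₁ < ⋯ < iₖ₋₁ < i, the
-- probability that t spans an edge on them is the average over v ∈ Bᵢ of
-- |Lk(v; Bᵢ₁, …, Bᵢₖ₋₁)| / |Bᵢ₁|⋯|Bᵢₖ₋₁|, hence at most ε. There are at most N = mᵏ such index
-- tuples, so for ε = 1/(N+1) the expected number of edges inside t is below 1 and some transversal
-- is independent. Probabilities are replaced by counts throughout: the probability of an event
-- depending on the parts of an index tuple only is computed by summing over the other coordinates.

module FirstMoment where

  open import Level using (Level)
  open import Data.Bool using (Bool; true; false; T; _∧_; if_then_else_)
  import Data.Bool as Bool
  open import Data.Bool.Properties using (∧-identityʳ)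
  open import Data.Empty using (⊥-elim)
  open import Data.Fin using (Fin; fromℕ; inject₁; toℕ) renaming (zero to fzero; suc to fsuc)
  import Data.Fin as Fin
  open import Data.Fin.Properties using (_≟_; all?; any?; <-cmp; <-irrefl; toℕ-inject₁; toℕ-fromℕ; inject₁ℕ<)
  open import Data.Fin.Subset using (Subset; ⁅_⁆; _∪_; _∩_; ⋃; ∣_∣; _∈_; _⊆_; Nonempty)
  open import Data.Fin.Subset.Properties using (x∈p∪q⁻; x∈p∪q⁺; ∉⊥; ⊆-antisym; x∈p∩q⁺; x∈p∩q⁻; x∈⁅x⁆; x∈⁅y⁆⇒x≡y; ∣⁅x⁆∣≡1; x∈p⇒∣p-x∣<∣p∣; _⊆?_; _∈?_; ∪-comm)
  open import Data.List using (List; []; _∷_; [_]; _++_; map; concatMap; length; tabulate; filterᵇ; allFin)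
  open import Data.List.Properties using (map-++; length-map; tabulate-cong)
  open import Data.List.Membership.Propositional using (find; lose) renaming (_∈_ to _∈ₗ_)
  open import Data.List.Membership.Propositional.Properties using (∈-concatMap⁺; ∈-concatMap⁻; ∈-map⁺; ∈-map⁻; ∈-++⁺ˡ; ∈-++⁺ʳ; ∈-allFin)
  open import Data.List.Relation.Unary.Any using (here; there)
  open import Data.Nat using (ℕ; zero; suc; _+_; _*_; _≤_; _<_; z≤n; s≤s)
  open import Data.Nat.ListAction using (sum; product)
  open import Data.Nat.ListAction.Properties using (sum-++)
  open import Data.Nat.Properties
    using (+-assoc; +-comm; +-identityʳ; *-zeroʳ; *-identityˡ; *-identityʳ; *-comm; *-assoc; *-distribˡ-+;
           +-mono-≤; *-mono-≤; *-monoʳ-≤; *-cancelˡ-<; ≤-<-trans; m<n+m; ≤-refl; ≤-trans; ≤-reflexive; ≤-antisym; ≤-pred; m≤m+n; m≤n+m; 1+n≰n; module ≤-Reasoning)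
  import Data.Integer as ℤ
  import Data.Integer.Properties as ℤP
  open import Data.Nat.Coprimality using (1-coprimeTo) renaming (sym to coprime-sym)
  open import Data.Rational using (ℚ; 0ℚ; _/_; mkℚ)
  import Data.Rational as ℚ
  import Data.Rational.Properties as ℚP
  import Data.Rational.Unnormalised as ℚᵘ
  import Data.Rational.Unnormalised.Properties as ℚᵘP
  import Data.Sign.Base as Sign
  open import Data.Product using (∃; _×_; _,_; proj₁; proj₂)
  open import Data.Sum using (_⊎_; inj₁; inj₂; [_,_]′)
  open import Data.Vec using (_∷_; here; there)
  open import Data.Vec.Properties using (≡-dec; lookup∘tabulate; lookup⇒[]=; []=⇒lookup)
  open import Data.Vec.Functional using () renaming (_∷_ to _∷ᶠ_)
  open import Function using (_∘_)
  open import Function.Definitions using (Injective)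
  open import Relation.Binary.Definitions using (DecidableEquality; tri<; tri≈; tri>)
  open import Relation.Binary.PropositionalEquality using (_≡_; refl; sym; trans; cong; cong₂; subst; subst₂; _≗_; module ≡-Reasoning)
  open import Relation.Nullary using (Dec; yes; no; does)
  open import Relation.Nullary.Decidable using (dec-true; dec-false; isYes≗does; ⌊_⌋; _×-dec_; _→-dec_)

  open import Defs

  private
    variable
      a b : Level
      A : Set a
      B′ : Set b
      k m n r : ℕ

  ∑ : List A → (A → ℕ) → ℕ
  ∑ xs g = sum (map g xs)

  module _ {g h : A → ℕ} where

    ∑-cong : ∀ xs → (∀ x → x ∈ₗ xs → g x ≡ h x) → ∑ xs g ≡ ∑ xs h
    ∑-cong []       p = refl
    ∑-cong (x ∷ xs) p = cong₂ _+_ (p x (here refl)) (∑-cong xs (λ y q → p y (there q)))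

    ∑-mono : ∀ xs → (∀ x → x ∈ₗ xs → g x ≤ h x) → ∑ xs g ≤ ∑ xs h
    ∑-mono []       p = z≤n
    ∑-mono (x ∷ xs) p = +-mono-≤ (p x (here refl)) (∑-mono xs (λ y q → p y (there q)))

    ∑-+ : ∀ xs → ∑ xs (λ x → g x + h x) ≡ ∑ xs g + ∑ xs h
    ∑-+ []       = refl
    ∑-+ (x ∷ xs) = begin
      g x + h x + ∑ xs (λ x → g x + h x) ≡⟨ cong (g x + h x +_) (∑-+ xs) ⟩
      g x + h x + (∑ xs g + ∑ xs h)      ≡⟨ +-assoc (g x) (h x) _ ⟩
      g x + (h x + (∑ xs g + ∑ xs h))    ≡⟨ cong (g x +_) (sym (+-assoc (h x) _ _)) ⟩
      g x + (h x + ∑ xs g + ∑ xs h)      ≡⟨ cong (λ z → g x + (z + ∑ xs h)) (+-comm (h x) _) ⟩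
      g x + (∑ xs g + h x + ∑ xs h)      ≡⟨ cong (g x +_) (+-assoc (∑ xs g) _ _) ⟩
      g x + (∑ xs g + (h x + ∑ xs h))    ≡⟨ sym (+-assoc (g x) _ _) ⟩
      g x + ∑ xs g + (h x + ∑ xs h)      ∎
      where open ≡-Reasoning

  ∑-*ˡ : ∀ (xs : List A) c g → ∑ xs (λ x → c * g x) ≡ c * ∑ xs g
  ∑-*ˡ []       c g = sym (*-zeroʳ c)
  ∑-*ˡ (x ∷ xs) c g = trans (cong (c * g x +_) (∑-*ˡ xs c g)) (sym (*-distribˡ-+ c (g x) _))

  ∑-*ʳ : ∀ (xs : List A) c g → ∑ xs (λ x → g x * c) ≡ ∑ xs g * c
  ∑-*ʳ xs c g = trans (∑-cong xs (λ x _ → *-comm (g x) c)) (trans (∑-*ˡ xs c g) (*-comm c _))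

  ∑-zero : ∀ (xs : List A) → ∑ xs (λ _ → 0) ≡ 0
  ∑-zero []       = refl
  ∑-zero (x ∷ xs) = ∑-zero xs

  ∑-one : ∀ (xs : List A) → ∑ xs (λ _ → 1) ≡ length xs
  ∑-one []       = refl
  ∑-one (x ∷ xs) = cong suc (∑-one xs)

  ∈⇒≤∑ : ∀ {xs : List A} g {y} → y ∈ₗ xs → g y ≤ ∑ xs g
  ∈⇒≤∑ {xs = x ∷ xs} g (here refl) = m≤m+n (g x) _
  ∈⇒≤∑ {xs = x ∷ xs} g (there p)   = ≤-trans (∈⇒≤∑ g p) (m≤n+m _ (g x))

  ∑<length⇒∃zero : ∀ (xs : List A) g → ∑ xs g < length xs → ∃ λ x → x ∈ₗ xs × g x ≡ 0
  ∑<length⇒∃zero (x ∷ xs) g p with g x in eq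
  ... | zero  = x , here refl , eq
  ... | suc c =
    let (y , q , gy) = ∑<length⇒∃zero xs g (≤-trans (s≤s (m≤n+m _ c)) (≤-pred p)) in y , there q , gy

  ∑≤1 : ∀ (xs : List A) g → (∀ x → x ∈ₗ xs → 1 ≤ g x → ∑ xs g ≤ 1) → ∑ xs g ≤ 1
  ∑≤1 []       g p = z≤n
  ∑≤1 (x ∷ xs) g p with g x in eq
  ... | suc c = p x (here refl) (subst (1 ≤_) (sym eq) (s≤s z≤n))
  ... | zero  = ∑≤1 xs g (λ y q → p y (there q))

  ∑-map : ∀ (f : A → B′) xs g → ∑ (map f xs) g ≡ ∑ xs (g ∘ f)
  ∑-map f []       g = refl
  ∑-map f (x ∷ xs) g = cong (g (f x) +_) (∑-map f xs g)

  ∑-swap : ∀ (xs : List A) (ys : List B′) (g : A → B′ → ℕ) → ∑ xs (λ x → ∑ ys (g x)) ≡ ∑ ys (λ y → ∑ xs (λ x → g x y))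
  ∑-swap []       ys g = sym (∑-zero ys)
  ∑-swap (x ∷ xs) ys g = trans (cong (∑ ys (g x) +_) (∑-swap xs ys g)) (sym (∑-+ {g = g x} ys))

  ∑-concatMap : ∀ (f : A → List B′) xs g → ∑ (concatMap f xs) g ≡ ∑ xs (λ x → ∑ (f x) g)
  ∑-concatMap f []       g = refl
  ∑-concatMap f (x ∷ xs) g = begin
    sum (map g (f x ++ concatMap f xs))       ≡⟨ cong sum (map-++ g (f x) _) ⟩
    sum (map g (f x) ++ map g (concatMap f xs)) ≡⟨ sum-++ (map g (f x)) _ ⟩
    ∑ (f x) g + ∑ (concatMap f xs) g                   ≡⟨ cong (∑ (f x) g +_) (∑-concatMap f xs g) ⟩
    ∑ (f x) g + ∑ xs (λ x → ∑ (f x) g)                 ∎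
    where open ≡-Reasoning

  ∏ : (Fin k → ℕ) → ℕ
  ∏ c = product (tabulate c)

  ∏-cong : ∀ {c d : Fin k → ℕ} → (∀ b → c b ≡ d b) → ∏ c ≡ ∏ d
  ∏-cong {zero}  p = refl
  ∏-cong {suc k} p = cong₂ _*_ (p fzero) (∏-cong (p ∘ fsuc))

  ∏-mono : ∀ {c d : Fin k → ℕ} → (∀ b → c b ≤ d b) → ∏ c ≤ ∏ d
  ∏-mono {zero}  p = ≤-refl
  ∏-mono {suc k} p = *-mono-≤ (p fzero) (∏-mono (p ∘ fsuc))

  ∏-one : ∀ k → ∏ {k} (λ _ → 1) ≡ 1
  ∏-one zero    = refl
  ∏-one (suc k) = trans (+-identityʳ _) (∏-one k)

  ∏-* : ∀ (c d : Fin k → ℕ) → ∏ (λ l → c l * d l) ≡ ∏ c * ∏ d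
  ∏-* {zero}  c d = refl
  ∏-* {suc k} c d = begin
    c₀ * d₀ * ∏ (λ l → c (fsuc l) * d (fsuc l)) ≡⟨ cong (c₀ * d₀ *_) (∏-* (c ∘ fsuc) (d ∘ fsuc)) ⟩
    c₀ * d₀ * (C * D)                           ≡⟨ *-assoc c₀ d₀ _ ⟩
    c₀ * (d₀ * (C * D))                         ≡⟨ cong (c₀ *_) (sym (*-assoc d₀ C D)) ⟩
    c₀ * (d₀ * C * D)                           ≡⟨ cong (λ z → c₀ * (z * D)) (*-comm d₀ C) ⟩
    c₀ * (C * d₀ * D)                           ≡⟨ cong (c₀ *_) (*-assoc C d₀ D) ⟩
    c₀ * (C * (d₀ * D))                         ≡⟨ sym (*-assoc c₀ C _) ⟩
    c₀ * C * (d₀ * D)                           ∎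
    where
    open ≡-Reasoning
    c₀ = c fzero
    d₀ = d fzero
    C = ∏ (c ∘ fsuc)
    D = ∏ (d ∘ fsuc)

  ∏-swap : ∀ (h : Fin k → Fin m → ℕ) → ∏ (λ b → ∏ (h b)) ≡ ∏ (λ l → ∏ (λ b → h b l))
  ∏-swap {zero}  {m} h = sym (∏-one m)
  ∏-swap {suc k}     h = trans (cong (∏ (h fzero) *_) (∏-swap (h ∘ fsuc))) (sym (∏-* (h fzero) _))

  ∏-positive : ∀ (c : Fin k → ℕ) → (∀ b → 1 ≤ c b) → 1 ≤ ∏ c
  ∏-positive {k} c p = subst (_≤ ∏ c) (∏-one k) (∏-mono p)

  positive-∏ : ∀ (c : Fin k → ℕ) → 1 ≤ ∏ c → ∀ b → 1 ≤ c b
  positive-∏ {suc k} c p fzero with c fzero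
  ... | zero  = ⊥-elim (1+n≰n p)
  ... | suc _ = s≤s z≤n
  positive-∏ {suc k} c p (fsuc b) = positive-∏ (c ∘ fsuc) (1≤m*n⇒1≤n (c fzero) _ p) b
    where
    1≤m*n⇒1≤n : ∀ x y → 1 ≤ x * y → 1 ≤ y
    1≤m*n⇒1≤n x zero    q = ⊥-elim (1+n≰n (subst (1 ≤_) (*-zeroʳ x) q))
    1≤m*n⇒1≤n x (suc y) q = s≤s z≤n

  ∏-if-≟ : ∀ (j : Fin m) (c : Fin m → ℕ) → ∏ (λ l → if does (j ≟ l) then c l else 1) ≡ c j
  ∏-if-≟ {suc m} fzero    c = trans (cong (c fzero *_) (∏-one m)) (*-identityʳ _)
  ∏-if-≟ {suc m} (fsuc j) c = trans (+-identityʳ _) (∏-if-≟ j (c ∘ fsuc))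

  𝟙 : Bool → ℕ
  𝟙 true  = 1
  𝟙 false = 0

  𝟙-T : ∀ x → T x → 𝟙 x ≡ 1
  𝟙-T true _ = refl

  module _ {p} {P : Set p} where

    𝟙-yes : ∀ (P? : Dec P) → P → 𝟙 (does P?) ≡ 1
    𝟙-yes P? x = cong 𝟙 (dec-true P? x)

    𝟙-positive : ∀ (P? : Dec P) → 1 ≤ 𝟙 (does P?) → P
    𝟙-positive (yes x) _ = x
    𝟙-positive (no _)  ()

  does-≟-sym : ∀ (_≟ᴬ_ : DecidableEquality A) x y → does (x ≟ᴬ y) ≡ does (y ≟ᴬ x)
  does-≟-sym _≟ᴬ_ x y with x ≟ᴬ y | y ≟ᴬ x
  ... | yes _   | yes _   = refl
  ... | no _    | no _    = refl
  ... | yes x≡y | no y≢x  = ⊥-elim (y≢x (sym x≡y))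
  ... | no x≢y  | yes y≡x = ⊥-elim (x≢y (sym y≡x))

  -- Transversals of a family of lists

  transversals : (Fin k → List A) → List (Fin k → A)
  transversals {k = zero}  L = [ (λ ()) ]
  transversals {k = suc k} L = concatMap (λ x → map (x ∷ᶠ_) (transversals (L ∘ fsuc))) (L fzero)

  ∑-transversals : ∀ (L : Fin (suc k) → List A) g →
    ∑ (transversals L) g ≡ ∑ (L fzero) (λ x → ∑ (transversals (L ∘ fsuc)) (λ t → g (x ∷ᶠ t)))
  ∑-transversals L g =
    trans (∑-concatMap _ (L fzero) g) (∑-cong (L fzero) (λ x _ → ∑-map (x ∷ᶠ_) (transversals (L ∘ fsuc)) g))

  ∑-transversals-∏ : ∀ (L : Fin k → List A) (φ : Fin k → A → ℕ) →
    ∑ (transversals L) (λ t → ∏ (λ l → φ l (t l))) ≡ ∏ (λ l → ∑ (L l) (φ l))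
  ∑-transversals-∏ {k = zero}  L φ = refl
  ∑-transversals-∏ {k = suc k} L φ = begin
    ∑ (transversals L) (λ t → ∏ (λ l → φ l (t l)))
      ≡⟨ ∑-transversals L _ ⟩
    ∑ (L fzero) (λ x → ∑ (transversals L′) (λ t → φ fzero x * ∏ (λ l → φ′ l (t l))))
      ≡⟨ ∑-cong (L fzero) (λ x _ → ∑-*ˡ (transversals L′) (φ fzero x) _) ⟩
    ∑ (L fzero) (λ x → φ fzero x * ∑ (transversals L′) (λ t → ∏ (λ l → φ′ l (t l))))
      ≡⟨ ∑-cong (L fzero) (λ x _ → cong (φ fzero x *_) (∑-transversals-∏ L′ φ′)) ⟩
    ∑ (L fzero) (λ x → φ fzero x * ∏ (λ l → ∑ (L′ l) (φ′ l)))
      ≡⟨ ∑-*ʳ (L fzero) _ (φ fzero) ⟩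
    ∏ (λ l → ∑ (L l) (φ l)) ∎
    where
    open ≡-Reasoning
    L′ = L ∘ fsuc
    φ′ = φ ∘ fsuc

  length-transversals : ∀ (L : Fin k → List A) → length (transversals L) ≡ ∏ (λ l → length (L l))
  length-transversals {k = k} L = begin
    length (transversals L)                        ≡⟨ sym (∑-one (transversals L)) ⟩
    ∑ (transversals L) (λ _ → 1)                   ≡⟨ ∑-cong (transversals L) (λ _ _ → sym (∏-one k)) ⟩
    ∑ (transversals L) (λ _ → ∏ {k} (λ _ → 1))     ≡⟨ ∑-transversals-∏ L (λ _ _ → 1) ⟩
    ∏ (λ l → ∑ (L l) (λ _ → 1))                    ≡⟨ ∏-cong (λ l → ∑-one (L l)) ⟩
    ∏ (λ l → length (L l))                         ∎
    where open ≡-Reasoning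

  ∈-transversals⁻ : ∀ (L : Fin k → List A) {t} → t ∈ₗ transversals L → ∀ l → t l ∈ₗ L l
  ∈-transversals⁻ {k = suc k} L p l with find (∈-concatMap⁻ _ {xs = L fzero} p)
  ... | x , x∈ , q with ∈-map⁻ (x ∷ᶠ_) q
  ... | t , t∈ , refl with l
  ...   | fzero  = x∈
  ...   | fsuc l = ∈-transversals⁻ (L ∘ fsuc) t∈ l

  ∈-transversals⁺ : ∀ (L : Fin k → List A) {s} → (∀ l → s l ∈ₗ L l) → ∃ λ t → t ∈ₗ transversals L × t ≗ s
  ∈-transversals⁺ {k = zero}  L p = _ , here refl , λ ()
  ∈-transversals⁺ {k = suc k} L {s} p with ∈-transversals⁺ (L ∘ fsuc) (p ∘ fsuc)
  ... | t , t∈ , t≗s =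
    s fzero ∷ᶠ t ,
    ∈-concatMap⁺ _ (lose (p fzero) (∈-map⁺ (s fzero ∷ᶠ_) t∈)) ,
    λ { fzero → refl ; (fsuc l) → t≗s l }

  multiplicity : Fin n → List (Fin n) → ℕ
  multiplicity y xs = ∑ xs (λ x → 𝟙 (does (y ≟ x)))

  NoDuplicates : List (Fin n) → Set
  NoDuplicates xs = ∀ y → multiplicity y xs ≤ 1

  multiplicity-∈ : ∀ {y} {xs : List (Fin n)} → NoDuplicates xs → y ∈ₗ xs → multiplicity y xs ≡ 1
  multiplicity-∈ {y = y} {xs} nd y∈ =
    ≤-antisym (nd y) (subst (_≤ multiplicity y xs) (𝟙-yes (y ≟ y) refl) (∈⇒≤∑ (λ x → 𝟙 (does (y ≟ x))) y∈))

  -- Transversals are functions, which lack decidable equality; they are compared pointwise instead.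
  agreement : (Fin k → Fin n) → (Fin k → Fin n) → ℕ
  agreement s w = ∏ (λ b → 𝟙 (does (s b ≟ w b)))

  agreement-≗ : ∀ {s w : Fin k → Fin n} → s ≗ w → agreement s w ≡ 1
  agreement-≗ {k} {s = s} {w} s≗w = trans (∏-cong (λ b → 𝟙-yes (s b ≟ w b) (s≗w b))) (∏-one k)

  positive-agreement : ∀ (s w : Fin k → Fin n) → 1 ≤ agreement s w → s ≗ w
  positive-agreement s w p b = 𝟙-positive (s b ≟ w b) (positive-∏ _ p b)

  ∑-agreement : ∀ (L : Fin k → List (Fin n)) {s} → (∀ l → NoDuplicates (L l)) → (∀ l → s l ∈ₗ L l) →
    ∑ (transversals L) (agreement s) ≡ 1
  ∑-agreement {k} L {s} nd s∈ = begin
    ∑ (transversals L) (λ w → ∏ (λ b → 𝟙 (does (s b ≟ w b)))) ≡⟨ ∑-transversals-∏ L (λ b x → 𝟙 (does (s b ≟ x))) ⟩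
    ∏ (λ b → multiplicity (s b) (L b))                      ≡⟨ ∏-cong (λ b → multiplicity-∈ (nd b) (s∈ b)) ⟩
    ∏ {k} (λ _ → 1)                                          ≡⟨ ∏-one k ⟩
    1                                                        ∎
    where open ≡-Reasoning

  Respects-≗ : ((Fin k → A) → ℕ) → Set _
  Respects-≗ F = ∀ {s w} → s ≗ w → F s ≡ F w

  ∑-sift : ∀ (L : Fin k → List (Fin n)) {s} → (∀ l → NoDuplicates (L l)) → (∀ l → s l ∈ₗ L l) →
    ∀ F → Respects-≗ F → ∑ (transversals L) (λ w → F w * agreement s w) ≡ F s
  ∑-sift L {s} nd s∈ F resp = begin
    ∑ (transversals L) (λ w → F w * agreement s w) ≡⟨ ∑-cong (transversals L) (λ w _ → replace w) ⟩
    ∑ (transversals L) (λ w → F s * agreement s w) ≡⟨ ∑-*ˡ (transversals L) (F s) (agreement s) ⟩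
    F s * ∑ (transversals L) (agreement s)         ≡⟨ cong (F s *_) (∑-agreement L nd s∈) ⟩
    F s * 1                                        ≡⟨ *-identityʳ _ ⟩
    F s                                            ∎
    where
    open ≡-Reasoning
    replace : ∀ w → F w * agreement s w ≡ F s * agreement s w
    replace w with agreement s w in eq
    ... | zero  = trans (*-zeroʳ (F w)) (sym (*-zeroʳ (F s)))
    ... | suc _ = cong (_* suc _) (resp (λ b → sym (positive-agreement s w (subst (1 ≤_) (sym eq) (s≤s z≤n)) b)))

  does-≟-injective : ∀ {g : Fin k → Fin m} → Injective _≡_ _≡_ g → ∀ a b → does (g a ≟ g b) ≡ does (a ≟ b)
  does-≟-injective {g = g} inj a b with a ≟ b
  ... | yes refl = dec-true (g a ≟ g a) refl
  ... | no a≢b   = dec-false (g a ≟ g b) (a≢b ∘ inj)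

  -- Write F (t ∘ g) as ∑ over w of F w ⋅ agreement (t ∘ g) w and swap the sums: summed over t, the
  -- agreement factorises over the coordinates, and M counts the extensions of w to a transversal of L.
  marginal : ∀ (L : Fin m → List (Fin n)) (g : Fin k → Fin m) → (∀ l → NoDuplicates (L l)) → Injective _≡_ _≡_ g →
    ∃ λ M → ∀ F → Respects-≗ F → ∑ (transversals L) (λ t → F (t ∘ g)) ≡ M * ∑ (transversals (L ∘ g)) F
  marginal {m = m} {n = n} {k = k} L g nd inj = M , sum-marginal
    where
    κ : ∀ l → Dec (∃ λ b → g b ≡ l) → ℕ
    κ l (yes _) = 1
    κ l (no _)  = length (L l)

    M : ℕ
    M = ∏ (λ l → κ l (any? (λ b → g b ≟ l)))

    module _ (w : Fin k → Fin n) (w∈ : ∀ b → w b ∈ₗ L (g b)) where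

      ψ : Fin m → Fin n → ℕ
      ψ l x = ∏ (λ b → if does (g b ≟ l) then 𝟙 (does (x ≟ w b)) else 1)

      ∑ψ : ∀ l d → ∑ (L l) (ψ l) ≡ κ l d
      ∑ψ l (yes (b₀ , refl)) = begin
        ∑ (L (g b₀)) (ψ (g b₀))                   ≡⟨ ∑-cong (L (g b₀)) (λ x _ → select x) ⟩
        ∑ (L (g b₀)) (λ x → 𝟙 (does (x ≟ w b₀)))  ≡⟨ ∑-cong (L (g b₀)) (λ x _ → cong 𝟙 (does-≟-sym _≟_ x (w b₀))) ⟩
        multiplicity (w b₀) (L (g b₀))            ≡⟨ multiplicity-∈ (nd (g b₀)) (w∈ b₀) ⟩
        1                                         ∎
        where
        open ≡-Reasoning
        select : ∀ x → ψ (g b₀) x ≡ 𝟙 (does (x ≟ w b₀))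
        select x = trans (∏-cong (λ b → cong (λ z → if z then 𝟙 (does (x ≟ w b)) else 1)
                                        (trans (does-≟-injective inj b b₀) (does-≟-sym _≟_ b b₀))))
                         (∏-if-≟ b₀ (λ b → 𝟙 (does (x ≟ w b))))
      ∑ψ l (no ∄b) = trans (∑-cong (L l) (λ x _ → trans (∏-cong (λ b → cong (λ z → if z then _ else 1)
                                                                           (dec-false (g b ≟ l) (∄b ∘ (b ,_)))))
                                                        (∏-one k)))
                           (∑-one (L l))

      fibre : ∑ (transversals L) (λ t → agreement (t ∘ g) w) ≡ M
      fibre = begin
        ∑ (transversals L) (λ t → agreement (t ∘ g) w)
          ≡⟨ ∑-cong (transversals L) (λ t _ → trans (∏-cong (λ b → sym (∏-if-≟ (g b) (λ l → 𝟙 (does (t l ≟ w b))))))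
                                                    (∏-swap (λ b l → if does (g b ≟ l) then 𝟙 (does (t l ≟ w b)) else 1))) ⟩
        ∑ (transversals L) (λ t → ∏ (λ l → ψ l (t l))) ≡⟨ ∑-transversals-∏ L ψ ⟩
        ∏ (λ l → ∑ (L l) (ψ l))                        ≡⟨ ∏-cong (λ l → ∑ψ l (any? (λ b → g b ≟ l))) ⟩
        M                                              ∎
        where open ≡-Reasoning

    sum-marginal : ∀ F → Respects-≗ F → ∑ (transversals L) (λ t → F (t ∘ g)) ≡ M * ∑ (transversals (L ∘ g)) F
    sum-marginal F resp = begin
      ∑ (transversals L) (λ t → F (t ∘ g))
        ≡⟨ ∑-cong (transversals L) (λ t t∈ → sym (∑-sift (L ∘ g) nd′ (∈-transversals⁻ L t∈ ∘ g) F resp)) ⟩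
      ∑ (transversals L) (λ t → ∑ Ws (λ w → F w * agreement (t ∘ g) w))
        ≡⟨ ∑-swap (transversals L) Ws _ ⟩
      ∑ Ws (λ w → ∑ (transversals L) (λ t → F w * agreement (t ∘ g) w))
        ≡⟨ ∑-cong Ws (λ w _ → ∑-*ˡ (transversals L) (F w) _) ⟩
      ∑ Ws (λ w → F w * ∑ (transversals L) (λ t → agreement (t ∘ g) w))
        ≡⟨ ∑-cong Ws (λ w w∈ → cong (F w *_) (fibre w (∈-transversals⁻ (L ∘ g) w∈))) ⟩
      ∑ Ws (λ w → F w * M) ≡⟨ ∑-*ʳ Ws M F ⟩
      ∑ Ws F * M           ≡⟨ *-comm _ M ⟩
      M * ∑ Ws F           ∎
      where
      open ≡-Reasoning
      Ws = transversals (L ∘ g)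
      nd′ : ∀ b → NoDuplicates (L (g b))
      nd′ = nd ∘ g

  elements : Subset n → List (Fin n)
  elements {zero}  _            = []
  elements {suc n} (true ∷ p)  = fzero ∷ map fsuc (elements p)
  elements {suc n} (false ∷ p) = map fsuc (elements p)

  ∈-elements⁺ : ∀ {x : Fin n} {p} → x ∈ p → x ∈ₗ elements p
  ∈-elements⁺                    here      = here refl
  ∈-elements⁺ {p = true ∷ p}  (there q) = there (∈-map⁺ fsuc (∈-elements⁺ q))
  ∈-elements⁺ {p = false ∷ p} (there q) = ∈-map⁺ fsuc (∈-elements⁺ q)

  ∈-elements⁻ : ∀ {x : Fin n} {p} → x ∈ₗ elements p → x ∈ p
  ∈-elements⁻ {suc n} {p = true ∷ p} (here refl) = here
  ∈-elements⁻ {suc n} {p = true ∷ p} (there q) with ∈-map⁻ fsuc q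
  ... | y , r , refl = there (∈-elements⁻ r)
  ∈-elements⁻ {suc n} {p = false ∷ p} q with ∈-map⁻ fsuc q
  ... | y , r , refl = there (∈-elements⁻ r)

  length-elements : ∀ (p : Subset n) → length (elements p) ≡ ∣ p ∣
  length-elements {zero}  Data.Vec.[]  = refl
  length-elements {suc n} (true ∷ p)  = cong suc (trans (length-map fsuc (elements p)) (length-elements p))
  length-elements {suc n} (false ∷ p) = trans (length-map fsuc (elements p)) (length-elements p)

  multiplicity-map-fsuc : ∀ (y : Fin n) xs → multiplicity (fsuc y) (map fsuc xs) ≡ multiplicity y xs
  multiplicity-map-fsuc y xs = ∑-map fsuc xs _

  multiplicity-fzero-map-fsuc : ∀ (xs : List (Fin n)) → multiplicity fzero (map fsuc xs) ≡ 0
  multiplicity-fzero-map-fsuc xs = trans (∑-map fsuc xs _) (∑-zero xs)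

  elements-noDuplicates : ∀ (p : Subset n) → NoDuplicates (elements p)
  elements-noDuplicates {zero}  _           y        = z≤n
  elements-noDuplicates {suc n} (true ∷ p)  fzero    = ≤-reflexive (cong suc (multiplicity-fzero-map-fsuc (elements p)))
  elements-noDuplicates {suc n} (true ∷ p)  (fsuc y) = subst (_≤ 1) (sym (multiplicity-map-fsuc y (elements p))) (elements-noDuplicates p y)
  elements-noDuplicates {suc n} (false ∷ p) fzero    = ≤-trans (≤-reflexive (multiplicity-fzero-map-fsuc (elements p))) z≤n
  elements-noDuplicates {suc n} (false ∷ p) (fsuc y) = subst (_≤ 1) (sym (multiplicity-map-fsuc y (elements p))) (elements-noDuplicates p y)

  ∈-allSubsets : ∀ (e : Subset n) → e ∈ₗ allSubsets n
  ∈-allSubsets {zero}  Data.Vec.[]  = here refl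
  ∈-allSubsets {suc n} (true ∷ e)  = ∈-++⁺ˡ (∈-map⁺ (true ∷_) (∈-allSubsets e))
  ∈-allSubsets {suc n} (false ∷ e) = ∈-++⁺ʳ (map (true ∷_) (allSubsets n)) (∈-map⁺ (false ∷_) (∈-allSubsets e))

  length-filterᵇ : ∀ (P : A → Bool) xs → length (filterᵇ P xs) ≡ ∑ xs (𝟙 ∘ P)
  length-filterᵇ P []       = refl
  length-filterᵇ P (x ∷ xs) with P x
  ... | true  = cong suc (length-filterᵇ P xs)
  ... | false = length-filterᵇ P xs

  ∈-⋃-tabulate⁻ : ∀ (V : Fin k → Subset n) {x} → x ∈ ⋃ (tabulate V) → ∃ λ b → x ∈ V b
  ∈-⋃-tabulate⁻ {zero}  V p = ⊥-elim (∉⊥ p)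
  ∈-⋃-tabulate⁻ {suc k} V p with x∈p∪q⁻ (V fzero) _ p
  ... | inj₁ q = fzero , q
  ... | inj₂ q = let (b , r) = ∈-⋃-tabulate⁻ (V ∘ fsuc) q in fsuc b , r

  ∈-⋃-tabulate⁺ : ∀ (V : Fin k → Subset n) {x} b → x ∈ V b → x ∈ ⋃ (tabulate V)
  ∈-⋃-tabulate⁺ {suc k} V fzero    q = x∈p∪q⁺ (inj₁ q)
  ∈-⋃-tabulate⁺ {suc k} V (fsuc b) q = x∈p∪q⁺ {p = V fzero} (inj₂ (∈-⋃-tabulate⁺ (V ∘ fsuc) b q))

  ∈-imageSet⁻ : ∀ (u : Fin k → Fin n) {x} → x ∈ imageSet u → ∃ λ a → x ≡ u a
  ∈-imageSet⁻ u p = let (a , q) = ∈-⋃-tabulate⁻ (⁅_⁆ ∘ u) p in a , x∈⁅y⁆⇒x≡y (u a) q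

  ∈-imageSet⁺ : ∀ (u : Fin k → Fin n) a → u a ∈ imageSet u
  ∈-imageSet⁺ u a = ∈-⋃-tabulate⁺ (⁅_⁆ ∘ u) a (x∈⁅x⁆ (u a))

  imageSet-cong : ∀ {u w : Fin k → Fin n} → u ≗ w → imageSet u ≡ imageSet w
  imageSet-cong u≗w = cong ⋃ (tabulate-cong (cong ⁅_⁆ ∘ u≗w))

  -- Transversals of link graphs

  _≟ₛ_ : DecidableEquality (Subset n)
  _≟ₛ_ = ≡-dec Bool._≟_

  StrictlyIncreasing⇒Injective : ∀ {f : Fin r → Fin m} → StrictlyIncreasing f → Injective _≡_ _≡_ f
  StrictlyIncreasing⇒Injective {f = f} inc {a} {b} fa≡fb with <-cmp a b
  ... | tri< a<b _ _ = ⊥-elim (<-irrefl fa≡fb (inc a b a<b))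
  ... | tri≈ _ a≡b _ = a≡b
  ... | tri> _ _ b<a = ⊥-elim (<-irrefl (sym fa≡fb) (inc b a b<a))

  module _ {B : Fin m → Subset n} (disjoint : PairwiseDisjoint B) where

    part-unique : ∀ {x p q} → x ∈ B p → x ∈ B q → p ≡ q
    part-unique {x} {p} {q} x∈p x∈q with p ≟ q
    ... | yes p≡q = p≡q
    ... | no p≢q  = ⊥-elim (disjoint p q p≢q (x , x∈p∩q⁺ (x∈p , x∈q)))

    module _ {f : Fin r → Fin m} (f-inj : Injective _≡_ _≡_ f) where

      private
        Us = transversals (elements ∘ B ∘ f)

        ∈-part : ∀ {u} → u ∈ₗ Us → ∀ a → u a ∈ B (f a)
        ∈-part u∈ a = ∈-elements⁻ (∈-transversals⁻ _ u∈ a)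

      imageSet∩part : ∀ {u} → u ∈ₗ Us → ∀ a → imageSet u ∩ B (f a) ≡ ⁅ u a ⁆
      imageSet∩part {u} u∈ a = ⊆-antisym ⊆⁅ua⁆ ⁅ua⁆⊆
        where
        ⊆⁅ua⁆ : imageSet u ∩ B (f a) ⊆ ⁅ u a ⁆
        ⊆⁅ua⁆ y∈ with x∈p∩q⁻ (imageSet u) (B (f a)) y∈
        ... | y∈u , y∈B with ∈-imageSet⁻ u y∈u
        ... | b , refl with f-inj (part-unique (∈-part u∈ b) y∈B)
        ... | refl = x∈⁅x⁆ (u a)
        ⁅ua⁆⊆ : ⁅ u a ⁆ ⊆ imageSet u ∩ B (f a)
        ⁅ua⁆⊆ y∈ with x∈⁅y⁆⇒x≡y (u a) y∈
        ... | refl = x∈p∩q⁺ (∈-imageSet⁺ u a , ∈-part u∈ a)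

      imageSet-injective : ∀ {u w} → u ∈ₗ Us → w ∈ₗ Us → imageSet u ≡ imageSet w → u ≗ w
      imageSet-injective {u} {w} u∈ w∈ eq b with ∈-imageSet⁻ w (subst (u b ∈_) eq (∈-imageSet⁺ u b))
      ... | a , ub≡wa with f-inj (part-unique (subst (_∈ B (f a)) (sym ub≡wa) (∈-part w∈ a)) (∈-part u∈ b))
      ... | refl = ub≡wa

      isLinkEdge-imageSet : ∀ {k} (H : Hypergraph k n) x {u} → u ∈ₗ Us →
        isLinkEdge H x (B ∘ f) (imageSet u) ≡ edge H (imageSet u ∪ ⁅ x ⁆)
      isLinkEdge-imageSet H x {u} u∈ = begin
        edge H (imageSet u ∪ ⁅ x ⁆) ∧ ⌊ one-per-part? ⌋ ∧ ⌊ inside? ⌋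
          ≡⟨ cong₂ (λ p q → edge H (imageSet u ∪ ⁅ x ⁆) ∧ p ∧ q)
                   (trans (isYes≗does one-per-part?) (dec-true one-per-part? one-per-part))
                   (trans (isYes≗does inside?) (dec-true inside? inside)) ⟩
        edge H (imageSet u ∪ ⁅ x ⁆) ∧ true ≡⟨ ∧-identityʳ _ ⟩
        edge H (imageSet u ∪ ⁅ x ⁆) ∎
        where
        open ≡-Reasoning
        one-per-part? = all? (λ a → ∣ imageSet u ∩ B (f a) ∣ Data.Nat.≟ 1)
        one-per-part : ∀ a → ∣ imageSet u ∩ B (f a) ∣ ≡ 1
        one-per-part a = trans (cong ∣_∣ (imageSet∩part u∈ a)) (∣⁅x⁆∣≡1 (u a))
        inside? = imageSet u ⊆? ⋃ (tabulate (B ∘ f))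
        inside : imageSet u ⊆ ⋃ (tabulate (B ∘ f))
        inside y∈ with ∈-imageSet⁻ u y∈
        ... | a , refl = ∈-⋃-tabulate⁺ (B ∘ f) a (∈-part u∈ a)

      ∑-imageSet≟≤1 : ∀ e → ∑ Us (λ u → 𝟙 (does (imageSet u ≟ₛ e))) ≤ 1
      ∑-imageSet≟≤1 e = ∑≤1 Us _ λ u₀ u₀∈ pos → begin
        ∑ Us (λ u → 𝟙 (does (imageSet u ≟ₛ e))) ≤⟨ ∑-mono Us (λ u u∈ → ≤-agreement u₀∈ (𝟙-positive (imageSet u₀ ≟ₛ e) pos) u u∈) ⟩
        ∑ Us (agreement u₀)                     ≡⟨ ∑-agreement _ (elements-noDuplicates ∘ B ∘ f) (∈-transversals⁻ _ u₀∈) ⟩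
        1                                       ∎
        where
        open ≤-Reasoning
        ≤-agreement : ∀ {u₀} → u₀ ∈ₗ Us → imageSet u₀ ≡ e → ∀ u → u ∈ₗ Us → 𝟙 (does (imageSet u ≟ₛ e)) ≤ agreement u₀ u
        ≤-agreement {u₀} u₀∈ eq u u∈ with imageSet u ≟ₛ e
        ... | no _   = z≤n
        ... | yes eq′ = ≤-reflexive (sym (agreement-≗ (imageSet-injective u₀∈ u∈ (trans eq (sym eq′)))))

      -- Distinct transversals span distinct link edges.
      ∑-edge≤linkSize : ∀ {k} (H : Hypergraph k n) x → ∑ Us (λ u → 𝟙 (edge H (imageSet u ∪ ⁅ x ⁆))) ≤ linkSize H x (B ∘ f)
      ∑-edge≤linkSize H x = begin
        ∑ Us (λ u → 𝟙 (edge H (imageSet u ∪ ⁅ x ⁆)))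
          ≡⟨ ∑-cong Us (λ u u∈ → cong 𝟙 (sym (isLinkEdge-imageSet H x u∈))) ⟩
        ∑ Us (P ∘ imageSet)
          ≤⟨ ∑-mono Us (λ u _ → spread (imageSet u)) ⟩
        ∑ Us (λ u → ∑ Es (λ e → P e * 𝟙 (does (imageSet u ≟ₛ e))))
          ≡⟨ ∑-swap Us Es _ ⟩
        ∑ Es (λ e → ∑ Us (λ u → P e * 𝟙 (does (imageSet u ≟ₛ e))))
          ≡⟨ ∑-cong Es (λ e _ → ∑-*ˡ Us (P e) _) ⟩
        ∑ Es (λ e → P e * ∑ Us (λ u → 𝟙 (does (imageSet u ≟ₛ e))))
          ≤⟨ ∑-mono Es (λ e _ → ≤-trans (*-monoʳ-≤ (P e) (∑-imageSet≟≤1 e)) (≤-reflexive (*-identityʳ (P e)))) ⟩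
        ∑ Es P
          ≡⟨ sym (length-filterᵇ _ Es) ⟩
        linkSize H x (B ∘ f) ∎
        where
        open ≤-Reasoning
        Es = allSubsets n
        P : Subset n → ℕ
        P = 𝟙 ∘ isLinkEdge H x (B ∘ f)
        spread : ∀ e → P e ≤ ∑ Es (λ e′ → P e′ * 𝟙 (does (e ≟ₛ e′)))
        spread e = subst (_≤ ∑ Es (λ e′ → P e′ * 𝟙 (does (e ≟ₛ e′))))
                     (trans (cong (P e *_) (𝟙-yes (e ≟ₛ e) refl)) (*-identityʳ _))
                     (∈⇒≤∑ (λ e′ → P e′ * 𝟙 (does (e ≟ₛ e′))) (∈-allSubsets e))

  -- Ordered index tuples

  -- The largest index comes first, matching the order in which the hypothesis lists i and i₁ < ⋯ < iᵣ.
  Ordered : (Fin (suc r) → Fin m) → Set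
  Ordered g = StrictlyIncreasing (g ∘ fsuc) × (∀ a → g (fsuc a) Fin.< g fzero)

  ordered? : ∀ (g : Fin (suc r) → Fin m) → Dec (Ordered g)
  ordered? g = (all? λ a → all? λ b → (a Fin.<? b) →-dec (g (fsuc a) Fin.<? g (fsuc b)))
             ×-dec (all? λ a → g (fsuc a) Fin.<? g fzero)

  Ordered-resp-≗ : ∀ {g h : Fin (suc r) → Fin m} → g ≗ h → Ordered g → Ordered h
  Ordered-resp-≗ g≗h (inc , below) =
    (λ a b a<b → subst₂ Fin._<_ (g≗h (fsuc a)) (g≗h (fsuc b)) (inc a b a<b)) ,
    (λ a → subst₂ Fin._<_ (g≗h (fsuc a)) (g≗h fzero) (below a))

  Ordered⇒Injective : ∀ {g : Fin (suc r) → Fin m} → Ordered g → Injective _≡_ _≡_ g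
  Ordered⇒Injective         (inc , below) {fzero}  {fzero}  _  = refl
  Ordered⇒Injective         (inc , below) {fzero}  {fsuc b} eq = ⊥-elim (<-irrefl (sym eq) (below b))
  Ordered⇒Injective         (inc , below) {fsuc a} {fzero}  eq = ⊥-elim (<-irrefl eq (below a))
  Ordered⇒Injective {g = g} (inc , below) {fsuc a} {fsuc b} eq = cong fsuc (StrictlyIncreasing⇒Injective {f = g ∘ fsuc} inc eq)

  enumerate : ∀ (S : Subset m) → Fin ∣ S ∣ → Fin m
  enumerate {suc m} (true ∷ S)  fzero    = fzero
  enumerate {suc m} (true ∷ S)  (fsuc a) = fsuc (enumerate S a)
  enumerate {suc m} (false ∷ S) a        = fsuc (enumerate S a)

  enumerate-∈ : ∀ (S : Subset m) a → enumerate S a ∈ S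
  enumerate-∈ {suc m} (true ∷ S)  fzero    = here
  enumerate-∈ {suc m} (true ∷ S)  (fsuc a) = there (enumerate-∈ S a)
  enumerate-∈ {suc m} (false ∷ S) a        = there (enumerate-∈ S a)

  enumerate-surjective : ∀ (S : Subset m) {l} → l ∈ S → ∃ λ a → enumerate S a ≡ l
  enumerate-surjective {suc m} (true ∷ S)  here      = fzero , refl
  enumerate-surjective {suc m} (true ∷ S)  (there p) = let (a , eq) = enumerate-surjective S p in fsuc a , cong fsuc eq
  enumerate-surjective {suc m} (false ∷ S) (there p) = let (a , eq) = enumerate-surjective S p in a , cong fsuc eq

  enumerate-increasing : ∀ (S : Subset m) → StrictlyIncreasing (enumerate S)
  enumerate-increasing {suc m} (true ∷ S)  fzero    (fsuc b) _         = s≤s z≤n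
  enumerate-increasing {suc m} (true ∷ S)  (fsuc a) (fsuc b) (s≤s a<b) = s≤s (enumerate-increasing S a b a<b)
  enumerate-increasing {suc m} (false ∷ S) a        b        a<b       = s≤s (enumerate-increasing S a b a<b)

  fromℕ⊎inject₁ : ∀ (b : Fin (suc r)) → b ≡ fromℕ r ⊎ ∃ λ a → b ≡ inject₁ a
  fromℕ⊎inject₁ {zero}  fzero    = inj₁ refl
  fromℕ⊎inject₁ {suc r} fzero    = inj₂ (fzero , refl)
  fromℕ⊎inject₁ {suc r} (fsuc b) with fromℕ⊎inject₁ b
  ... | inj₁ eq       = inj₁ (cong fsuc eq)
  ... | inj₂ (a , eq) = inj₂ (fsuc a , cong fsuc eq)

  -- Moving the last entry of an increasing tuple to the front gives an ordered tuple with the same entries.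
  rotate-increasing : ∀ {k} → k ≡ suc r → (h : Fin k → Fin m) → StrictlyIncreasing h →
    ∃ λ (g : Fin (suc r) → Fin m) → Ordered g × (∀ b → ∃ λ c → g b ≡ h c) × (∀ c → ∃ λ b → g b ≡ h c)
  rotate-increasing {r} refl h inc =
    h (fromℕ r) ∷ᶠ (h ∘ inject₁) ,
    ((λ a b a<b → inc _ _ (subst₂ Data.Nat._<_ (sym (toℕ-inject₁ a)) (sym (toℕ-inject₁ b)) a<b)) ,
     (λ a → inc _ _ (subst (toℕ (inject₁ a) <_) (sym (toℕ-fromℕ r)) (inject₁ℕ< a)))) ,
    (λ { fzero → _ , refl ; (fsuc a) → _ , refl }) ,
    λ c → [ (λ c≡ → fzero , cong h (sym c≡)) , (λ { (a , c≡) → fsuc a , cong h (sym c≡) }) ]′ (fromℕ⊎inject₁ c)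

  ordered-enumeration : ∀ (S : Subset m) → ∣ S ∣ ≡ suc r →
    ∃ λ (g : Fin (suc r) → Fin m) → Ordered g × (∀ b → g b ∈ S) × (∀ {l} → l ∈ S → ∃ λ b → g b ≡ l)
  ordered-enumeration S size with rotate-increasing size (enumerate S) (enumerate-increasing S)
  ... | g , ordered , g⊆ , ⊆g =
    g , ordered ,
    (λ b → let (c , eq) = g⊆ b in subst (_∈ S) (sym eq) (enumerate-∈ S c)) ,
    λ l∈ → let (c , eq) = enumerate-surjective S l∈ ; (b , eq′) = ⊆g c in b , trans eq′ eq

  preimage : (Fin m → Fin n) → Subset n → Subset m
  preimage t e = Data.Vec.tabulate (λ l → does (t l ∈? e))

  ∈-preimage⁺ : ∀ (t : Fin m → Fin n) {e l} → t l ∈ e → l ∈ preimage t e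
  ∈-preimage⁺ t {e} {l} tl∈e = lookup⇒[]= l _ (trans (lookup∘tabulate _ l) (dec-true (t l ∈? e) tl∈e))

  ∈-preimage⁻ : ∀ (t : Fin m → Fin n) {e l} → l ∈ preimage t e → t l ∈ e
  ∈-preimage⁻ t {e} {l} l∈ = from-does (t l ∈? e) (trans (sym (lookup∘tabulate _ l)) ([]=⇒lookup l∈))
    where
    from-does : ∀ {p} {P : Set p} (P? : Dec P) → does P? ≡ true → P
    from-does (yes x) _ = x

  ∣preimage∣ : ∀ {t : Fin m → Fin n} {e} → Injective _≡_ _≡_ t → (∀ {y} → y ∈ e → ∃ λ l → y ≡ t l) →
    ∣ preimage t e ∣ ≡ ∣ e ∣
  ∣preimage∣ {t = t} {e} t-inj e⊆ = begin
    ∣ S ∣                                                       ≡⟨ sym (length-elements S) ⟩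
    length (elements S)                                         ≡⟨ sym (∑-one (elements S)) ⟩
    ∑ (elements S) (λ _ → 1)                                    ≡⟨ ∑-cong (elements S) (λ l l∈ → sym (multiplicity-∈ (elements-noDuplicates e) (in-e l∈))) ⟩
    ∑ (elements S) (λ l → multiplicity (t l) (elements e))      ≡⟨ ∑-swap (elements S) (elements e) _ ⟩
    ∑ (elements e) (λ y → ∑ (elements S) (λ l → 𝟙 (does (t l ≟ y)))) ≡⟨ ∑-cong (elements e) (λ y y∈ → one-preimage (∈-elements⁻ y∈)) ⟩
    ∑ (elements e) (λ _ → 1)                                    ≡⟨ ∑-one (elements e) ⟩
    length (elements e)                                         ≡⟨ length-elements e ⟩
    ∣ e ∣                                                       ∎
    where
    open ≡-Reasoning
    S = preimage t e
    in-e : ∀ {l} → l ∈ₗ elements S → t l ∈ₗ elements e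
    in-e l∈ = ∈-elements⁺ (∈-preimage⁻ t (∈-elements⁻ l∈))
    one-preimage : ∀ {y} → y ∈ e → ∑ (elements S) (λ l → 𝟙 (does (t l ≟ y))) ≡ 1
    one-preimage y∈ with e⊆ y∈
    ... | l₀ , refl = begin
      ∑ (elements S) (λ l → 𝟙 (does (t l ≟ t l₀))) ≡⟨ ∑-cong (elements S) (λ l _ → cong 𝟙 (trans (does-≟-injective t-inj l l₀) (does-≟-sym _≟_ l l₀))) ⟩
      multiplicity l₀ (elements S)                  ≡⟨ multiplicity-∈ (elements-noDuplicates S) (∈-elements⁺ (∈-preimage⁺ t y∈)) ⟩
      1                                             ∎

  1/suc : ℕ → ℚ
  1/suc N = ℤ.+ 1 / suc N

  1/suc-positive : ∀ N → 0ℚ ℚ.< 1/suc N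
  1/suc-positive N = ℚP.positive⁻¹ (1/suc N) {{ℚP.normalize-pos 1 (suc N)}}

  -- ℚ's _/_ normalises, so these normal forms are what the order on ℚ actually compares.
  n/1≡mkℚ : ∀ a → (ℤ.+ a) / 1 ≡ mkℚ (ℤ.+ a) 0 (coprime-sym (1-coprimeTo a))
  n/1≡mkℚ a = ℚP.normalize-coprime (coprime-sym (1-coprimeTo a))

  1/suc≡mkℚ : ∀ N → 1/suc N ≡ mkℚ (ℤ.+ 1) N (1-coprimeTo (suc N))
  1/suc≡mkℚ N = ℚP.normalize-coprime (1-coprimeTo (suc N))

  ≤1/suc*⇒suc*≤ : ∀ N L P → (ℤ.+ L) / 1 ℚ.≤ 1/suc N ℚ.* ((ℤ.+ P) / 1) → suc N * L ≤ P
  ≤1/suc*⇒suc*≤ N L P L≤ with ℚᵘP.≤-respʳ-≃ (ℚP.toℚᵘ-homo-* (1/suc N) ((ℤ.+ P) / 1)) (ℚP.toℚᵘ-mono-≤ L≤)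
  ... | L≤ᵘ rewrite n/1≡mkℚ L | 1/suc≡mkℚ N | n/1≡mkℚ P with L≤ᵘ
  ... | ℚᵘ.*≤* L*[1+N]≤P*1 = ≤-trans (≤-reflexive (*-comm (suc N) L)) (ℤP.drop‿+≤+ (subst₂ ℤ._≤_ lhs rhs L*[1+N]≤P*1))
    where
    lhs : ℤ.+ L ℤ.* (ℤ.+ suc (N * 1)) ≡ ℤ.+ (L * suc N)
    lhs = trans (sym (ℤP.pos-* L (suc (N * 1)))) (cong (λ c → ℤ.+ (L * suc c)) (*-identityʳ N))
    rhs : (Sign.+ ℤ.◃ P + 0) ℤ.* (ℤ.+ 1) ≡ ℤ.+ P
    rhs = trans (ℤP.*-identityʳ _) (trans (ℤP.+◃n≡+n (P + 0)) (cong ℤ.+_ (+-identityʳ P)))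

  -- The first-moment argument

  indexTuples : ∀ r m → List (Fin (suc r) → Fin m)
  indexTuples r m = transversals (λ _ → allFin m)

  suc*≤*⇒< : ∀ N X W → suc N * X ≤ N * W → 1 ≤ W → X < W
  suc*≤*⇒< N X W N+1X≤NW 1≤W = *-cancelˡ-< (suc N) X W (≤-<-trans N+1X≤NW (m<n+m (N * W) 1≤W))

  module _ (H : Hypergraph (suc r) n) {B : Fin m → Subset n} (disjoint : PairwiseDisjoint B) where

    private
      Ts = transversals (elements ∘ B)

    spans : (Fin m → Fin n) → (Fin (suc r) → Fin m) → ℕ
    spans t g = 𝟙 (edge H (imageSet (t ∘ g)))

    ∑-spans : ∀ D g → Ordered g →
      (∀ v → v ∈ B (g fzero) → D * linkSize H v (B ∘ g ∘ fsuc) ≤ sizeProduct (B ∘ g ∘ fsuc)) →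
      D * ∑ Ts (λ t → spans t g) ≤ length Ts
    ∑-spans D g ordered link-bound = begin
      D * ∑ Ts (λ t → F (t ∘ g))             ≡⟨ cong (D *_) (marginal-of F F-resp) ⟩
      D * (M * ∑ Ws F)                        ≡⟨ sym (*-assoc D M _) ⟩
      D * M * ∑ Ws F                          ≡⟨ cong (_* ∑ Ws F) (*-comm D M) ⟩
      M * D * ∑ Ws F                          ≡⟨ *-assoc M D _ ⟩
      M * (D * ∑ Ws F)                        ≤⟨ *-monoʳ-≤ M per-tuple ⟩
      M * ∑ Ws (λ _ → 1)                      ≡⟨ sym (marginal-of (λ _ → 1) (λ _ → refl)) ⟩
      ∑ Ts (λ _ → 1)                          ≡⟨ ∑-one Ts ⟩
      length Ts                               ∎
      where
      open ≤-Reasoning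
      f = g ∘ fsuc
      Ws = transversals (elements ∘ B ∘ g)
      Us = transversals (elements ∘ B ∘ f)
      F : (Fin (suc r) → Fin n) → ℕ
      F w = 𝟙 (edge H (imageSet w))
      F-resp : Respects-≗ F
      F-resp w≗w′ = cong (𝟙 ∘ edge H) (imageSet-cong w≗w′)
      M-marginal = marginal (elements ∘ B) g (elements-noDuplicates ∘ B) (Ordered⇒Injective ordered)
      M = proj₁ M-marginal
      marginal-of = proj₂ M-marginal
      per-vertex : ∀ x → x ∈ₗ elements (B (g fzero)) → D * ∑ Us (λ u → F (x ∷ᶠ u)) ≤ ∑ Us (λ _ → 1)
      per-vertex x x∈ = begin
        D * ∑ Us (λ u → 𝟙 (edge H (⁅ x ⁆ ∪ imageSet u)))
          ≡⟨ cong (D *_) (∑-cong Us (λ u _ → cong (𝟙 ∘ edge H) (∪-comm ⁅ x ⁆ (imageSet u)))) ⟩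
        D * ∑ Us (λ u → 𝟙 (edge H (imageSet u ∪ ⁅ x ⁆)))
          ≤⟨ *-monoʳ-≤ D (∑-edge≤linkSize disjoint (StrictlyIncreasing⇒Injective (proj₁ ordered)) H x) ⟩
        D * linkSize H x (B ∘ f)
          ≤⟨ link-bound x (∈-elements⁻ x∈) ⟩
        sizeProduct (B ∘ f)
          ≡⟨ sym (trans (∑-one Us) (trans (length-transversals (elements ∘ B ∘ f)) (∏-cong (length-elements ∘ B ∘ f)))) ⟩
        ∑ Us (λ _ → 1) ∎
      per-tuple : D * ∑ Ws F ≤ ∑ Ws (λ _ → 1)
      per-tuple = begin
        D * ∑ Ws F                                           ≡⟨ cong (D *_) (∑-transversals (elements ∘ B ∘ g) F) ⟩
        D * ∑ (elements (B (g fzero))) (λ x → ∑ Us (λ u → F (x ∷ᶠ u)))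
          ≡⟨ sym (∑-*ˡ (elements (B (g fzero))) D _) ⟩
        ∑ (elements (B (g fzero))) (λ x → D * ∑ Us (λ u → F (x ∷ᶠ u)))
          ≤⟨ ∑-mono (elements (B (g fzero))) per-vertex ⟩
        ∑ (elements (B (g fzero))) (λ x → ∑ Us (λ _ → 1))  ≡⟨ sym (∑-transversals (elements ∘ B ∘ g) (λ _ → 1)) ⟩
        ∑ Ws (λ _ → 1)                                       ∎

    bad : (Fin m → Fin n) → ℕ
    bad t = ∑ (indexTuples r m) (λ g → if does (ordered? g) then spans t g else 0)

    ∑-bad : ∀ D → (∀ g → Ordered g →
        ∀ v → v ∈ B (g fzero) → D * linkSize H v (B ∘ g ∘ fsuc) ≤ sizeProduct (B ∘ g ∘ fsuc)) →
      D * ∑ Ts bad ≤ length (indexTuples r m) * length Ts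
    ∑-bad D link-bound = begin
      D * ∑ Ts (λ t → ∑ Gs (λ g → c g t))      ≡⟨ cong (D *_) (∑-swap Ts Gs _) ⟩
      D * ∑ Gs (λ g → ∑ Ts (c g))              ≡⟨ sym (∑-*ˡ Gs D _) ⟩
      ∑ Gs (λ g → D * ∑ Ts (c g))              ≤⟨ ∑-mono Gs (λ g _ → per-tuple g (ordered? g)) ⟩
      ∑ Gs (λ _ → length Ts)                   ≡⟨ ∑-cong Gs (λ _ _ → sym (*-identityˡ _)) ⟩
      ∑ Gs (λ _ → 1 * length Ts)               ≡⟨ ∑-*ʳ Gs (length Ts) (λ _ → 1) ⟩
      ∑ Gs (λ _ → 1) * length Ts               ≡⟨ cong (_* length Ts) (∑-one Gs) ⟩
      length Gs * length Ts                    ∎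
      where
      open ≤-Reasoning
      Gs = indexTuples r m
      c : (Fin (suc r) → Fin m) → (Fin m → Fin n) → ℕ
      c g t = if does (ordered? g) then spans t g else 0
      per-tuple : ∀ g (o? : Dec (Ordered g)) → D * ∑ Ts (λ t → if does o? then spans t g else 0) ≤ length Ts
      per-tuple g (yes ordered) = ∑-spans D g ordered (link-bound g ordered)
      per-tuple g (no _)        = ≤-trans (≤-reflexive (trans (cong (D *_) (∑-zero Ts)) (*-zeroʳ D))) z≤n

    ∈-Ts⇒∈B : ∀ {t} → t ∈ₗ Ts → ∀ l → t l ∈ B l
    ∈-Ts⇒∈B t∈ l = ∈-elements⁻ (∈-transversals⁻ _ t∈ l)

    ∈-Ts⇒injective : ∀ {t} → t ∈ₗ Ts → Injective _≡_ _≡_ t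
    ∈-Ts⇒injective t∈ {l} {l′} eq = part-unique disjoint (∈-Ts⇒∈B t∈ l) (subst (_∈ B l′) (sym eq) (∈-Ts⇒∈B t∈ l′))

    -- An edge inside a transversal meets |e| parts; listing them largest first names a bad index tuple.
    bad≡0⇒independent : ∀ {t} → t ∈ₗ Ts → bad t ≡ 0 → Independent H (imageSet t)
    bad≡0⇒independent {t} t∈ bad≡0 e e∈H e⊆t
      with ordered-enumeration (preimage t e)
             (trans (∣preimage∣ (∈-Ts⇒injective t∈) (∈-imageSet⁻ t ∘ e⊆t)) (uniform H e e∈H))
    ... | g , ordered , g⊆S , S⊆g with ∈-transversals⁺ (λ _ → allFin m) (λ b → ∈-allFin (g b))
    ... | g₀ , g₀∈ , g₀≗g = 1+n≰n (subst (1 ≤_) bad≡0 (begin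
      1                                               ≡⟨ sym spans-g₀ ⟩
      (if does (ordered? g₀) then spans t g₀ else 0)  ≤⟨ ∈⇒≤∑ (λ g → if does (ordered? g) then spans t g else 0) g₀∈ ⟩
      bad t                                           ∎))
      where
      open ≤-Reasoning
      imageSet≡e : imageSet (t ∘ g) ≡ e
      imageSet≡e = ⊆-antisym ⊆e e⊆
        where
        ⊆e : imageSet (t ∘ g) ⊆ e
        ⊆e y∈ with ∈-imageSet⁻ (t ∘ g) y∈
        ... | b , refl = ∈-preimage⁻ t (g⊆S b)
        e⊆ : e ⊆ imageSet (t ∘ g)
        e⊆ y∈ with ∈-imageSet⁻ t (e⊆t y∈)
        ... | l , refl with S⊆g (∈-preimage⁺ t y∈)
        ... | b , refl = ∈-imageSet⁺ (t ∘ g) b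
      spans-g₀ : (if does (ordered? g₀) then spans t g₀ else 0) ≡ 1
      spans-g₀ rewrite dec-true (ordered? g₀) (Ordered-resp-≗ (sym ∘ g₀≗g) ordered) =
        trans (cong (𝟙 ∘ edge H) (trans (imageSet-cong (cong t ∘ g₀≗g)) imageSet≡e)) (𝟙-T (edge H e) e∈H)

    independentTransversal : (∀ i → Nonempty (B i)) →
      (∀ g → Ordered g → ∀ v → v ∈ B (g fzero) →
         suc (length (indexTuples r m)) * linkSize H v (B ∘ g ∘ fsuc) ≤ sizeProduct (B ∘ g ∘ fsuc)) →
      IndependentTransversal H B
    independentTransversal nonempty link-bound with ∑<length⇒∃zero Ts bad ∑bad<∣Ts∣
      where
      N = length (indexTuples r m)
      ∣Ts∣≥1 : 1 ≤ length Ts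
      ∣Ts∣≥1 = subst (1 ≤_) (sym (length-transversals (elements ∘ B)))
        (∏-positive _ (λ l → let (x , x∈) = nonempty l in
           subst (1 ≤_) (sym (length-elements (B l))) (≤-trans (s≤s z≤n) (x∈p⇒∣p-x∣<∣p∣ x∈))))
      ∑bad<∣Ts∣ : ∑ Ts bad < length Ts
      ∑bad<∣Ts∣ = suc*≤*⇒< N (∑ Ts bad) (length Ts) (∑-bad (suc N) link-bound) ∣Ts∣≥1
    ... | t , t∈ , bad≡0 = t , ∈-Ts⇒∈B t∈ , bad≡0⇒independent t∈ bad≡0

open import Defs
open import Data.Nat using (ℕ; suc)
open import Data.Fin using (Fin; _<_)
open import Data.Fin.Subset using (Subset; _∈_; Nonempty)
open import Data.Integer using (+_)
open import Data.Rational using (ℚ; 0ℚ; _/_; _*_)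
import Data.Rational as ℚ
open import Data.Product using (∃; _×_; _,_)
open import Data.List using (length)
open FirstMoment using (indexTuples; independentTransversal; 1/suc; 1/suc-positive; ≤1/suc*⇒suc*≤)

lemma2p14 : (r m : ℕ) → ∃ λ (ε : ℚ) → ℚ._<_ 0ℚ ε ×
    ((n : ℕ) (H : Hypergraph (suc r) n) (B : Fin m → Subset n) →
     (∀ i → Nonempty (B i)) → PairwiseDisjoint B →
     (∀ (i : Fin m) (f : Fin r → Fin m) → StrictlyIncreasing f → (∀ a → f a < i) →
       ∀ v → v ∈ B i →
       ℚ._≤_ ((+ linkSize H v (λ a → B (f a))) / 1) (ε * ((+ sizeProduct (λ a → B (f a))) / 1))) →
     IndependentTransversal H B)
lemma2p14 r m = 1/suc N , 1/suc-positive N , λ n H B nonempty disjoint link-bound →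
  independentTransversal H disjoint nonempty λ g (increasing , below) v v∈ →
    ≤1/suc*⇒suc*≤ N _ _ (link-bound _ _ increasing below v v∈)
  where
  N : ℕ
  N = length (indexTuples r m)
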